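{- Let $t\ge 1$ be an integer. For every sufficiently large integer $n$, for every $t$-element set $T\subseteq[n]$ and every partition $\varpi=(W_1,W_2,W_3)$ of $[n]\setminus T$, we have $$s^\circ_t(n) > |W_1||W_2||W_3|+t\sum_{i=1}^3\binom{|W_i|}{2}+\binom{t}{3}+\frac{n}{10}.$$
   Context: For an integer $t\ge0$, $\mathrm{ex}(m,F_2^t)$ denotes the maximum number of hyperedges of an $m$-vertex $3$-uniform hypergraph in which every pair of vertices lies in at most $t$ hyperedges. $s^\circ_t(n)=\lfloor \tfrac n3\rfloor\lfloor \tfrac{n+1}3\rfloor\lfloor \tfrac{n+2}3\rfloor+\mathrm{ex}(\lfloor \tfrac n3\rfloor,F_2^t)+\mathrm{ex}(\lfloor \tfrac{n+1}3\rfloor,F_2^t)+\mathrm{ex}(\lfloor \tfrac{n+2}3\rfloor,F_2^t)$. (The quantity $|W_1||W_2||W_3|+t\sum_i\binom{|W_i|}{2}+\binom t3$ is the number of hyperedges of the $3$-graph with hyperedges: all triples meeting each $W_i$ once, all triples inside $T$, and all triples $\{v,x_1,x_2\}$ with $v\in T$ and $x_1,x_2$ in the same $W_i$.) -}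

module Defs where

open import Data.Nat using (ℕ; _+_; _*_; _≤_)
open import Data.Nat.DivMod using (_/_)
open import Data.Product using (Σ; _×_; ∃)
open import Data.Fin using (Fin)
open import Data.Fin.Subset using (Subset; ∣_∣; _∈_; _∪_; _∩_; ⊤; ⊥)
open import Data.Fin.Subset.Properties using (_∈?_)
open import Data.List using (List; length; filter)
open import Data.List.Relation.Unary.All using (All)
open import Data.List.Relation.Unary.Unique.Propositional using (Unique)
open import Relation.Nullary using (¬_)
open import Relation.Nullary.Decidable using (_×-dec_)
open import Relation.Binary.PropositionalEquality using (_≡_)

record ThreeGraph (m : ℕ) : Set where
  field
    edges    : List (Subset m)
    uniform  : All (λ e → ∣ e ∣ ≡ 3) edges
    distinct : Unique edges
open ThreeGraph public

size : ∀ {m} → ThreeGraph m → ℕ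
size H = length (edges H)

codeg : ∀ {m} → ThreeGraph m → Fin m → Fin m → ℕ
codeg H x y = length (filter (λ e → (x ∈? e) ×-dec (y ∈? e)) (edges H))

PairBounded : ∀ {m} → ℕ → ThreeGraph m → Set
PairBounded t H = ∀ x y → ¬ (x ≡ y) → codeg H x y ≤ t

IsEx : ℕ → ℕ → ℕ → Set
IsEx m t k =
  (Σ (ThreeGraph m) λ H → PairBounded t H × size H ≡ k) ×
  (∀ (H : ThreeGraph m) → PairBounded t H → size H ≤ k)

IsPartitionOfComplement : ∀ {n} → Subset n → Subset n → Subset n → Subset n → Set
IsPartitionOfComplement T W₁ W₂ W₃ =
  (T ∪ W₁ ∪ W₂ ∪ W₃ ≡ ⊤) ×
  (T ∩ W₁ ≡ ⊥) × (T ∩ W₂ ≡ ⊥) × (T ∩ W₃ ≡ ⊥) ×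
  (W₁ ∩ W₂ ≡ ⊥) × (W₁ ∩ W₃ ≡ ⊥) × (W₂ ∩ W₃ ≡ ⊥)

module Submission where

open import Defs
open import Data.Nat using (ℕ; _+_; _*_; _≤_; _<_)
open import Data.Nat.DivMod using (_/_)
open import Data.Nat.Combinatorics using (_C_)
open import Data.Nat.Properties using (+-assoc; m≤n⇒m≤n+o)
open import Data.Product using (Σ; _,_)
open import Data.Fin.Subset using (Subset; ∣_∣)
open import Relation.Binary.PropositionalEquality using (_≡_; trans; sym; cong₂; subst)

-- Let s = |W₁| + |W₂| + |W₃| = n − t and e = |W₁||W₂||W₃| + t Σ C(|Wᵢ|, 2) + C(t, 3).
--
-- Upper bound: 54e + 27ts ≤ 2s³ + 9ts² + 9t³ when s ≥ 27t. Its core is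
-- 27(2abc + t(a² + b² + c²)) ≤ 2s³ + 9ts² for the part sizes a, b, c: if all of them are at least t,
-- writing a = t + α, b = t + β, c = t + γ turns the slack into 2((α + β + γ)³ − 27αβγ), which is
-- AM–GM; if one of them is at most t, then 2abc ≤ 2t(ab + bc + ca) already suffices.
--
-- Lower bound: for j < t ≤ m, the triples {x < y < w} in ℤₘ with x + y + w ≡ j form edge-disjoint
-- families in which two vertices x, y lie in at most one edge, the one completed by w ≡ j − x − y.
-- Of the m² ordered pairs (x, y), at most 3m give a coincidence among x, y, w, and the six orderings
-- of (x, y, w) are equally frequent because (x, y) ↦ (y, x) and y ↦ w are bijections; so every
-- family has at least (m² − 3m)/6 edges and ex(m, F₂ᵗ) ≥ t(m² − 3m)/6. Together with
-- 27⌊n/3⌋⌊(n+1)/3⌋⌊(n+2)/3⌋ ≥ n³ − 3n − 2 this gives 162 s°ₜ(n) ≥ 6n³ + 9tn² − 81tn − 18n − 12.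
--
-- The coefficients of s³ and s²t in the two bounds agree, and the difference of the bounds is
-- 360st² − 120t³ − 810t² − 342(s + t) − 120, which is positive for s ≥ 27t + 100.

module Inequalities where

  open import Data.Nat using (zero; suc; z≤n)
  open import Data.Nat.Properties
    using (_≤?_; ≰⇒≥; m≤n⇒∃[o]m+o≡n; ≤-trans; ≤-reflexive; m≤m+n; m≤n+m; m≤n⇒m≤n+o; +-mono-≤; +-monoˡ-≤;
           +-monoʳ-≤; +-monoʳ-<; *-mono-≤; *-monoˡ-≤; *-monoʳ-≤; +-cancelʳ-≤; +-cancelʳ-<; *-cancelˡ-≤;
           *-assoc; *-comm; *-zeroʳ; module ≤-Reasoning)
  open import Data.List using ([]; _∷_)
  open import Data.Product using (_,_)
  open import Data.Sum using (_⊎_; inj₁; inj₂)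
  open import Relation.Nullary using (yes; no)
  open import Relation.Binary.PropositionalEquality
  open import Data.Nat.Tactic.RingSolver using (solve)

  m+k≡n⇒m≤n : ∀ {m n} k → m + k ≡ n → m ≤ n
  m+k≡n⇒m≤n {m} k refl = m≤m+n m k

  ≤-by-slack : ∀ {x y d e} → x + e ≡ y + d → d ≤ e → x ≤ y
  ≤-by-slack {x} {y} {d} {e} eq d≤e = +-cancelʳ-≤ e x y (≤-trans (≤-reflexive eq) (+-monoʳ-≤ y d≤e))

  <-by-slack : ∀ {x y d e} → x + e ≡ y + d → d < e → x < y
  <-by-slack {x} {y} {d} {e} eq d<e = +-cancelʳ-< e x y (≤-trans (≤-reflexive (cong suc eq)) (+-monoʳ-< y d<e))

  2mn≤m²+n² : ∀ m n → 2 * (m * n) ≤ m * m + n * n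
  2mn≤m²+n² zero    n       = z≤n
  2mn≤m²+n² (suc m) zero    = ≤-trans (≤-reflexive (cong (2 *_) (*-zeroʳ (suc m)))) z≤n
  2mn≤m²+n² (suc m) (suc n) = begin
    2 * (suc m * suc n)             ≡⟨ solve (m ∷ n ∷ []) ⟩
    2 * (m * n) + 2 * (m + n + 1)   ≤⟨ +-monoˡ-≤ _ (2mn≤m²+n² m n) ⟩
    m * m + n * n + 2 * (m + n + 1) ≡⟨ solve (m ∷ n ∷ []) ⟩
    suc m * suc m + suc n * suc n   ∎
    where open ≤-Reasoning

  xy+yz+zx≤x²+y²+z² : ∀ x y z → x * y + y * z + z * x ≤ x * x + y * y + z * z
  xy+yz+zx≤x²+y²+z² x y z = *-cancelˡ-≤ 2 (begin
    2 * (x * y + y * z + z * x)                         ≡⟨ solve (x ∷ y ∷ z ∷ []) ⟩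
    2 * (x * y) + 2 * (y * z) + 2 * (z * x)             ≤⟨ +-mono-≤ (+-mono-≤ (2mn≤m²+n² x y) (2mn≤m²+n² y z))
                                                                     (2mn≤m²+n² z x) ⟩
    (x * x + y * y) + (y * y + z * z) + (z * z + x * x) ≡⟨ solve (x ∷ y ∷ z ∷ []) ⟩
    2 * (x * x + y * y + z * z)                         ∎)
    where open ≤-Reasoning

  3[xy+yz+zx]≤[x+y+z]² : ∀ x y z → 3 * (x * y + y * z + z * x) ≤ (x + y + z) * (x + y + z)
  3[xy+yz+zx]≤[x+y+z]² x y z = begin
    3 * (x * y + y * z + z * x)                           ≡⟨ solve (x ∷ y ∷ z ∷ []) ⟩
    (x * y + y * z + z * x) + 2 * (x * y + y * z + z * x) ≤⟨ +-monoˡ-≤ _ (xy+yz+zx≤x²+y²+z² x y z) ⟩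
    (x * x + y * y + z * z) + 2 * (x * y + y * z + z * x) ≡⟨ solve (x ∷ y ∷ z ∷ []) ⟩
    (x + y + z) * (x + y + z)                             ∎
    where open ≤-Reasoning

  [x+y+z]²≤3[x²+y²+z²] : ∀ x y z → (x + y + z) * (x + y + z) ≤ 3 * (x * x + y * y + z * z)
  [x+y+z]²≤3[x²+y²+z²] x y z = begin
    (x + y + z) * (x + y + z)                             ≡⟨ solve (x ∷ y ∷ z ∷ []) ⟩
    (x * x + y * y + z * z) + 2 * (x * y + y * z + z * x) ≤⟨ +-monoʳ-≤ (x * x + y * y + z * z)
                                                               (*-monoʳ-≤ 2 (xy+yz+zx≤x²+y²+z² x y z)) ⟩
    (x * x + y * y + z * z) + 2 * (x * x + y * y + z * z) ≡⟨ solve (x ∷ y ∷ z ∷ []) ⟩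
    3 * (x * x + y * y + z * z)                           ∎
    where open ≤-Reasoning

  -- AM–GM, from 3(xy + yz + zx) ≤ (x + y + z)² applied to (x, y, z) and to (xy, yz, zx).
  27xyz≤[x+y+z]³ : ∀ x y z → 27 * (x * y * z) ≤ (x + y + z) * (x + y + z) * (x + y + z)
  27xyz≤[x+y+z]³ zero     y z = z≤n
  27xyz≤[x+y+z]³ (suc x′) y z = *-cancelˡ-≤ (suc x′ + y + z) (times-sum (suc x′) y z)
    where
    times-sum : ∀ x y z → (x + y + z) * (27 * (x * y * z))
                          ≤ (x + y + z) * ((x + y + z) * (x + y + z) * (x + y + z))
    times-sum x y z = begin
      (x + y + z) * (27 * (x * y * z))                                ≡⟨ solve (x ∷ y ∷ z ∷ []) ⟩
      9 * (3 * (x * y * (y * z) + y * z * (z * x) + z * x * (x * y))) ≤⟨ *-monoʳ-≤ 9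
                                                                  (3[xy+yz+zx]≤[x+y+z]² (x * y) (y * z) (z * x)) ⟩
      9 * ((x * y + y * z + z * x) * (x * y + y * z + z * x))         ≡⟨ solve (x ∷ y ∷ z ∷ []) ⟩
      (3 * (x * y + y * z + z * x)) * (3 * (x * y + y * z + z * x))   ≤⟨ *-mono-≤ (3[xy+yz+zx]≤[x+y+z]² x y z)
                                                                                  (3[xy+yz+zx]≤[x+y+z]² x y z) ⟩
      (x + y + z) * (x + y + z) * ((x + y + z) * (x + y + z))         ≡⟨ solve (x ∷ y ∷ z ∷ []) ⟩
      (x + y + z) * ((x + y + z) * (x + y + z) * (x + y + z))         ∎
      where open ≤-Reasoning

  abc≤t[ab+bc+ca] : ∀ {t} a b c → a ≤ t ⊎ b ≤ t ⊎ c ≤ t → a * b * c ≤ t * (a * b + b * c + c * a)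
  abc≤t[ab+bc+ca] {t} a b c (inj₁ a≤t) = begin
    a * b * c                   ≡⟨ *-assoc a b c ⟩
    a * (b * c)                 ≤⟨ *-mono-≤ a≤t (m≤n⇒m≤n+o (c * a) (m≤n+m (b * c) (a * b))) ⟩
    t * (a * b + b * c + c * a) ∎
    where open ≤-Reasoning
  abc≤t[ab+bc+ca] {t} a b c (inj₂ (inj₁ b≤t)) = begin
    a * b * c                   ≡⟨ solve (a ∷ b ∷ c ∷ []) ⟩
    b * (c * a)                 ≤⟨ *-mono-≤ b≤t (m≤n+m (c * a) (a * b + b * c)) ⟩
    t * (a * b + b * c + c * a) ∎
    where open ≤-Reasoning
  abc≤t[ab+bc+ca] {t} a b c (inj₂ (inj₂ c≤t)) = begin
    a * b * c                   ≡⟨ *-comm (a * b) c ⟩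
    c * (a * b)                 ≤⟨ *-mono-≤ c≤t (m≤n⇒m≤n+o (c * a) (m≤m+n (a * b) (b * c))) ⟩
    t * (a * b + b * c + c * a) ∎
    where open ≤-Reasoning

  cubic-bound-small-part : ∀ t a b c → 27 * t ≤ a + b + c → a ≤ t ⊎ b ≤ t ⊎ c ≤ t →
    27 * (2 * (a * b * c) + t * (a * a + b * b + c * c))
      ≤ 2 * ((a + b + c) * (a + b + c) * (a + b + c)) + 9 * t * ((a + b + c) * (a + b + c))
  cubic-bound-small-part t a b c 27t≤s small = begin
    27 * (2 * (a * b * c) + t * (a * a + b * b + c * c))
      ≤⟨ *-monoʳ-≤ 27 (+-monoˡ-≤ (t * (a * a + b * b + c * c)) (*-monoʳ-≤ 2 (abc≤t[ab+bc+ca] a b c small))) ⟩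
    27 * (2 * (t * (a * b + b * c + c * a)) + t * (a * a + b * b + c * c))
      ≡⟨ solve (t ∷ a ∷ b ∷ c ∷ []) ⟩
    27 * t * ((a + b + c) * (a + b + c))
      ≤⟨ *-monoˡ-≤ ((a + b + c) * (a + b + c)) 27t≤s ⟩
    (a + b + c) * ((a + b + c) * (a + b + c))
      ≤⟨ m≤m+n _ _ ⟩
    (a + b + c) * ((a + b + c) * (a + b + c))
      + ((a + b + c) * ((a + b + c) * (a + b + c)) + 9 * t * ((a + b + c) * (a + b + c)))
      ≡⟨ solve (t ∷ a ∷ b ∷ c ∷ []) ⟩
    2 * ((a + b + c) * (a + b + c) * (a + b + c)) + 9 * t * ((a + b + c) * (a + b + c)) ∎
    where open ≤-Reasoning

  cubic-bound-large-parts : ∀ {t a b c} → t ≤ a → t ≤ b → t ≤ c →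
    27 * (2 * (a * b * c) + t * (a * a + b * b + c * c))
      ≤ 2 * ((a + b + c) * (a + b + c) * (a + b + c)) + 9 * t * ((a + b + c) * (a + b + c))
  cubic-bound-large-parts {t} t≤a t≤b t≤c
    with α , refl ← m≤n⇒∃[o]m+o≡n t≤a
       | β , refl ← m≤n⇒∃[o]m+o≡n t≤b
       | γ , refl ← m≤n⇒∃[o]m+o≡n t≤c
       = ≤-by-slack slack (*-monoʳ-≤ 2 (27xyz≤[x+y+z]³ α β γ))
    where
    slack :
      27 * (2 * ((t + α) * (t + β) * (t + γ)) + t * ((t + α) * (t + α) + (t + β) * (t + β) + (t + γ) * (t + γ)))
        + 2 * ((α + β + γ) * (α + β + γ) * (α + β + γ))
      ≡ 2 * ((t + α + (t + β) + (t + γ)) * (t + α + (t + β) + (t + γ)) * (t + α + (t + β) + (t + γ)))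
        + 9 * t * ((t + α + (t + β) + (t + γ)) * (t + α + (t + β) + (t + γ)))
        + 2 * (27 * (α * β * γ))
    slack = solve (t ∷ α ∷ β ∷ γ ∷ [])

  cubic-bound : ∀ t a b c → 27 * t ≤ a + b + c →
    27 * (2 * (a * b * c) + t * (a * a + b * b + c * c))
      ≤ 2 * ((a + b + c) * (a + b + c) * (a + b + c)) + 9 * t * ((a + b + c) * (a + b + c))
  cubic-bound t a b c 27t≤s with t ≤? a | t ≤? b | t ≤? c
  ... | yes t≤a | yes t≤b | yes t≤c = cubic-bound-large-parts t≤a t≤b t≤c
  ... | no  t≰a | _       | _       = cubic-bound-small-part t a b c 27t≤s (inj₁ (≰⇒≥ t≰a))
  ... | yes _   | no  t≰b | _       = cubic-bound-small-part t a b c 27t≤s (inj₂ (inj₁ (≰⇒≥ t≰b)))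
  ... | yes _   | yes _   | no  t≰c = cubic-bound-small-part t a b c 27t≤s (inj₂ (inj₂ (≰⇒≥ t≰c)))

module Counting where

  open import Data.Nat using (zero; suc; z≤n; s≤s; z<s)
  open import Data.Nat.Properties
    using (+-0-commutativeMonoid; +-mono-≤; m≤m+n; m≤n⇒m≤o+n; n≤0⇒n≡0; ≮⇒≥; +-identityʳ;
           ≤-refl; ≤-trans; n≤1+n; <⇒≱; module ≤-Reasoning)
  open import Data.Fin using (Fin; zero; suc)
  open import Data.Fin.Properties using () renaming (suc-injective to fsuc-injective)
  open import Data.Product using (∃; _×_; _,_; proj₁; proj₂)
  open import Data.List using (List; []; _∷_; _++_; concat; tabulate; length; filter)
  open import Data.List.Properties using (length-++; filter-++; filter-some)
  open import Data.List.Relation.Unary.All using (All; []; _∷_)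
  open import Data.List.Relation.Unary.All.Properties using (¬Any⇒All¬)
  open import Data.List.Relation.Unary.Any as Any using (Any)
  open import Data.List.Relation.Unary.AllPairs using ([]; _∷_)
  open import Data.List.Relation.Unary.Unique.Propositional using (Unique)
  open import Relation.Nullary using (Dec; yes; no; ¬_)
  open import Relation.Nullary.Decidable using (_×-dec_)
  open import Relation.Nullary.Negation using (contradiction)
  open import Relation.Unary using (Pred; Decidable)
  open import Relation.Binary.Definitions using (DecidableEquality)
  open import Relation.Binary.PropositionalEquality
  open import Algebra.Properties.CommutativeMonoid.Sum +-0-commutativeMonoid
    using (sum-syntax) renaming (sum to ∑)

  χ : ∀ {p} {P : Set p} → Dec P → ℕ
  χ (yes _) = 1
  χ (no _)  = 0

  χ≤1 : ∀ {p} {P : Set p} (d : Dec P) → χ d ≤ 1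
  χ≤1 (yes _) = s≤s z≤n
  χ≤1 (no _)  = z≤n

  χ-pos : ∀ {p} {P : Set p} (d : Dec P) → 0 < χ d → P
  χ-pos (yes p) _ = p

  χ-yes : ∀ {p} {P : Set p} (d : Dec P) → P → 1 ≤ χ d
  χ-yes (yes _) _ = ≤-refl
  χ-yes (no ¬p) p = contradiction p ¬p

  ∑-mono-≤ : ∀ {n} {f g : Fin n → ℕ} → (∀ i → f i ≤ g i) → ∑ f ≤ ∑ g
  ∑-mono-≤ {zero}  f≤g = z≤n
  ∑-mono-≤ {suc n} f≤g = +-mono-≤ (f≤g zero) (∑-mono-≤ (λ i → f≤g (suc i)))

  ∑-const : ∀ n c → ∑[ i < n ] c ≡ n * c
  ∑-const zero    c = refl
  ∑-const (suc n) c = cong (c +_) (∑-const n c)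

  f≤∑f : ∀ {n} (f : Fin n → ℕ) i → f i ≤ ∑ f
  f≤∑f f zero    = m≤m+n (f zero) _
  f≤∑f f (suc i) = m≤n⇒m≤o+n (f zero) (f≤∑f (λ i → f (suc i)) i)

  ∑-pos : ∀ {n} (f : Fin n → ℕ) → 0 < ∑ f → ∃ λ i → 0 < f i
  ∑-pos {suc n} f pos with f zero in eq
  ... | suc _ = zero , subst (0 <_) (sym eq) z<s
  ... | zero  with i , 0<f[1+i] ← ∑-pos (λ i → f (suc i)) pos = suc i , 0<f[1+i]

  ∑≤1 : ∀ {n} (f : Fin n → ℕ) → (∀ i → f i ≤ 1) → (∀ {i k} → 0 < f i → 0 < f k → i ≡ k) → ∑ f ≤ 1
  ∑≤1 {zero}  f f≤1 unique = z≤n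
  ∑≤1 {suc n} f f≤1 unique with f zero in eq
  ... | zero  = ∑≤1 (λ i → f (suc i)) (λ i → f≤1 (suc i)) (λ pos pos′ → fsuc-injective (unique pos pos′))
  ... | suc k = begin
    suc k + ∑[ i < n ] f (suc i) ≡⟨ cong (suc k +_) (n≤0⇒n≡0 (≮⇒≥ rest-empty)) ⟩
    suc k + 0                    ≡⟨ +-identityʳ (suc k) ⟩
    suc k                        ≡⟨ eq ⟨
    f zero                       ≤⟨ f≤1 zero ⟩
    1                            ∎
    where
    open ≤-Reasoning
    rest-empty : ¬ (0 < ∑[ i < n ] f (suc i))
    rest-empty pos with i , 0<f[1+i] ← ∑-pos (λ i → f (suc i)) pos
      with () ← unique (subst (0 <_) (sym eq) z<s) 0<f[1+i]

  ∑∑≤1 : ∀ {p q} (g : Fin p → Fin q → ℕ) → (∀ a b → g a b ≤ 1) →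
         (∀ {a b a′ b′} → 0 < g a b → 0 < g a′ b′ → a ≡ a′ × b ≡ b′) →
         ∑[ a < p ] ∑[ b < q ] g a b ≤ 1
  ∑∑≤1 g g≤1 unique = ∑≤1 (λ a → ∑ (g a)) row≤1 row-unique
    where
    row≤1 : ∀ a → ∑ (g a) ≤ 1
    row≤1 a = ∑≤1 (g a) (g≤1 a) (λ pos pos′ → proj₂ (unique pos pos′))
    row-unique : ∀ {a a′} → 0 < ∑ (g a) → 0 < ∑ (g a′) → a ≡ a′
    row-unique {a} {a′} pos pos′ with b , pos-b ← ∑-pos (g a) pos | b′ , pos-b′ ← ∑-pos (g a′) pos′ =
      proj₁ (unique pos-b pos-b′)

  ∑∑∑≤1 : ∀ {p q r} (h : Fin p → Fin q → Fin r → ℕ) → (∀ a b c → h a b c ≤ 1) →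
          (∀ {a b c a′ b′ c′} → 0 < h a b c → 0 < h a′ b′ c′ → a ≡ a′ × b ≡ b′ × c ≡ c′) →
          ∑[ a < p ] ∑[ b < q ] ∑[ c < r ] h a b c ≤ 1
  ∑∑∑≤1 h h≤1 unique = ∑≤1 (λ a → ∑[ b < _ ] ∑ (h a b)) slice≤1 slice-unique
    where
    slice≤1 : ∀ a → ∑[ b < _ ] ∑ (h a b) ≤ 1
    slice≤1 a = ∑∑≤1 (h a) (h≤1 a) (λ pos pos′ → proj₂ (unique pos pos′))
    slice-unique : ∀ {a a′} → 0 < ∑[ b < _ ] ∑ (h a b) → 0 < ∑[ b < _ ] ∑ (h a′ b) → a ≡ a′
    slice-unique {a} {a′} pos pos′
      with b , pos-b ← ∑-pos (λ b → ∑ (h a b)) pos | b′ , pos-b′ ← ∑-pos (λ b → ∑ (h a′ b)) pos′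
      with c , pos-c ← ∑-pos (h a b) pos-b | c′ , pos-c′ ← ∑-pos (h a′ b′) pos-b′ =
      proj₁ (unique pos-c pos-c′)

  module _ {a} {A : Set a} where

    length-concat-tabulate : ∀ {n} (f : Fin n → List A) → length (concat (tabulate f)) ≡ ∑[ i < n ] length (f i)
    length-concat-tabulate {zero}  f = refl
    length-concat-tabulate {suc n} f = trans (length-++ (f zero))
      (cong (length (f zero) +_) (length-concat-tabulate (λ i → f (suc i))))

    count-concat-tabulate : ∀ {p} {P : Pred A p} (P? : Decidable P) {n} (f : Fin n → List A) →
      length (filter P? (concat (tabulate f))) ≡ ∑[ i < n ] length (filter P? (f i))
    count-concat-tabulate P? {zero}  f = refl
    count-concat-tabulate P? {suc n} f = begin
      length (filter P? (f zero ++ concat (tabulate (λ i → f (suc i)))))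
        ≡⟨ cong length (filter-++ P? (f zero) _) ⟩
      length (filter P? (f zero) ++ filter P? (concat (tabulate (λ i → f (suc i)))))
        ≡⟨ length-++ (filter P? (f zero)) ⟩
      length (filter P? (f zero)) + length (filter P? (concat (tabulate (λ i → f (suc i)))))
        ≡⟨ cong (length (filter P? (f zero)) +_) (count-concat-tabulate P? (λ i → f (suc i))) ⟩
      length (filter P? (f zero)) + ∑[ i < n ] length (filter P? (f (suc i))) ∎
      where open ≡-Reasoning

    keepIf : ∀ {p} {P : Set p} → Dec P → A → List A
    keepIf (yes _) x = x ∷ []
    keepIf (no _)  _ = []

    length-keepIf : ∀ {p} {P : Set p} (d : Dec P) x → length (keepIf d x) ≡ χ d
    length-keepIf (yes _) x = refl
    length-keepIf (no _)  x = refl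

    count-keepIf : ∀ {p q} {P : Set p} {Q : Pred A q} (Q? : Decidable Q) (d : Dec P) x →
      length (filter Q? (keepIf d x)) ≡ χ (d ×-dec Q? x)
    count-keepIf Q? (no _)  x = refl
    count-keepIf Q? (yes _) x with Q? x
    ... | yes _ = refl
    ... | no _  = refl

    All-keepIf : ∀ {p q} {P : Set p} {Q : Pred A q} (d : Dec P) {x} → (P → Q x) → All Q (keepIf d x)
    All-keepIf (yes p) P⇒Q = P⇒Q p ∷ []
    All-keepIf (no _)  P⇒Q = []

    module _ (_≟_ : DecidableEquality A) where

      count-∷ : ∀ x y xs → length (filter (_≟ y) xs) ≤ length (filter (_≟ y) (x ∷ xs))
      count-∷ x y xs with x ≟ y
      ... | yes _ = n≤1+n _
      ... | no _  = ≤-refl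

      Unique-if-counts≤1 : ∀ xs → (∀ y → length (filter (_≟ y) xs) ≤ 1) → Unique xs
      Unique-if-counts≤1 []       _        = []
      Unique-if-counts≤1 (x ∷ xs) counts≤1 =
        ¬Any⇒All¬ xs x∉xs ∷ Unique-if-counts≤1 xs (λ y → ≤-trans (count-∷ x y xs) (counts≤1 y))
        where
        x∉xs : ¬ Any (x ≡_) xs
        x∉xs x∈xs with x ≟ x | counts≤1 x
        ... | yes _  | s≤s count≤0 = <⇒≱ (filter-some (_≟ x) (Any.map sym x∈xs)) count≤0
        ... | no x≢x | _           = x≢x refl

module CyclicConstruction where

  open Counting
  open import Data.Nat using (zero; suc; _∸_; NonZero; z≤n)
  open import Data.Nat.Properties
    using (+-0-commutativeMonoid; +-*-semiring; +-commutativeSemigroup; +-identityʳ; +-suc; +-assoc;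
           m+[n∸m]≡n; m∸n+n≡m; <⇒≤; *-zeroʳ; *-identityʳ; +-monoˡ-≤; +-mono-≤; *-monoʳ-≤;
           m≤m+n; m≤n+m; m≤n⇒m≤n+o; ≤-trans; ≤-reflexive; module ≤-Reasoning)
  open import Data.Nat.DivMod
    using (_%_; _mod_; %-distribˡ-+; m%n%n≡m%n; m%n≤n; m%n<n; n%n≡0; m<n⇒m%n≡m; [m+n]%n≡m%n)
  open import Data.Nat.ListAction using (sum)
  open import Data.Nat.ListAction.Properties using (sum-↭)
  open import Data.Nat.Tactic.RingSolver using (solve-∀)
  open import Algebra.Properties.CommutativeSemigroup +-commutativeSemigroup using (xy∙z≈xz∙y)
  open import Algebra.Properties.CommutativeMonoid.Sum +-0-commutativeMonoid
    using (sum-syntax; ∑-comm; ∑-distrib-+; ∑-permute) renaming (sum-cong-≗ to ∑-cong)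
  open import Algebra.Properties.Semiring.Sum +-*-semiring using (*-distribˡ-sum)
  open import Data.Fin as Fin using (Fin; toℕ; inject≤)
  open import Data.Fin.Patterns using (0F; 1F; 2F; 3F; 4F; 5F)
  open import Data.Fin.Permutation using (Permutation; permutation)
  open import Data.Fin.Properties
    using (toℕ-fromℕ<; toℕ-injective; toℕ<n; inject≤-injective; _<?_; <-cmp; <⇒≢; <-trans; ≤-totalOrder)
    renaming (_≟_ to _≟ᶠ_)
  open import Data.Fin.Subset using (⁅_⁆; _∪_; _∩_; ⊥; ⋃; outside; inside) renaming (_∈_ to _∈ₛ_)
  open import Data.Fin.Subset.Properties
    using (_∈?_; x∈p∪q⁻; x∈p∪q⁺; x∈⁅x⁆; x∈⁅y⁆⇒x≡y; ∉⊥; ∣⁅x⁆∣≡1; ∣⊥∣≡0; Empty-unique; x∈p∩q⁻)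
  import Data.Bool as Bool
  open import Data.Vec using ([]; _∷_)
  open import Data.Vec.Properties using (≡-dec)
  open import Data.List using (List; []; _∷_; map; length; filter; concat; tabulate)
  open import Data.List.Membership.Propositional using (_∈_)
  open import Data.List.Relation.Unary.Any using (here; there)
  open import Data.List.Relation.Unary.All as All using (All; []; _∷_)
  open import Data.List.Relation.Unary.All.Properties using (concat⁺; tabulate⁺)
  open import Data.List.Relation.Unary.AllPairs using ([]; _∷_)
  open import Data.List.Relation.Unary.Unique.Propositional using (Unique)
  open import Data.List.Relation.Unary.Linked using ([-]; _∷_)
  open import Data.List.Relation.Unary.Sorted.TotalOrder.Properties using (↗↭↗⇒≋)
  open import Data.List.Relation.Binary.Pointwise using (_∷_)
  open import Data.List.Relation.Binary.Permutation.Propositional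
    using (_↭_; ↭-refl; ↭-prep; ↭-swap; ↭-trans; ↭-sym; ↭⇒↭ₛ)
  import Data.List.Relation.Binary.Permutation.Propositional.Properties as ↭
  open import Data.Product using (∃; _×_; _,_; proj₁; proj₂)
  open import Data.Sum using (inj₁; inj₂)
  open import Relation.Nullary using (Dec)
  open import Relation.Nullary.Decidable using (_×-dec_)
  open import Relation.Nullary.Negation using (contradiction)
  open import Relation.Unary using (Pred; Decidable)
  open import Relation.Binary.Definitions using (tri<; tri≈; tri>)
  open import Relation.Binary.PropositionalEquality

  ∣p∪q∣+∣p∩q∣≡∣p∣+∣q∣ : ∀ {n} (p q : Subset n) → ∣ p ∪ q ∣ + ∣ p ∩ q ∣ ≡ ∣ p ∣ + ∣ q ∣
  ∣p∪q∣+∣p∩q∣≡∣p∣+∣q∣ []            []            = refl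
  ∣p∪q∣+∣p∩q∣≡∣p∣+∣q∣ (outside ∷ p) (outside ∷ q) = ∣p∪q∣+∣p∩q∣≡∣p∣+∣q∣ p q
  ∣p∪q∣+∣p∩q∣≡∣p∣+∣q∣ (outside ∷ p) (inside  ∷ q) =
    trans (cong suc (∣p∪q∣+∣p∩q∣≡∣p∣+∣q∣ p q)) (sym (+-suc ∣ p ∣ ∣ q ∣))
  ∣p∪q∣+∣p∩q∣≡∣p∣+∣q∣ (inside  ∷ p) (outside ∷ q) = cong suc (∣p∪q∣+∣p∩q∣≡∣p∣+∣q∣ p q)
  ∣p∪q∣+∣p∩q∣≡∣p∣+∣q∣ (inside  ∷ p) (inside  ∷ q) =
    cong suc (trans (+-suc _ _) (trans (cong suc (∣p∪q∣+∣p∩q∣≡∣p∣+∣q∣ p q)) (sym (+-suc ∣ p ∣ ∣ q ∣))))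

  ∣p∪q∣≡∣p∣+∣q∣ : ∀ {n} {p q : Subset n} → p ∩ q ≡ ⊥ → ∣ p ∪ q ∣ ≡ ∣ p ∣ + ∣ q ∣
  ∣p∪q∣≡∣p∣+∣q∣ {n} {p} {q} p∩q≡⊥ = begin
    ∣ p ∪ q ∣             ≡⟨ +-identityʳ _ ⟨
    ∣ p ∪ q ∣ + 0         ≡⟨ cong (∣ p ∪ q ∣ +_) (∣⊥∣≡0 n) ⟨
    ∣ p ∪ q ∣ + ∣ ⊥ {n} ∣ ≡⟨ cong (λ r → ∣ p ∪ q ∣ + ∣ r ∣) p∩q≡⊥ ⟨
    ∣ p ∪ q ∣ + ∣ p ∩ q ∣ ≡⟨ ∣p∪q∣+∣p∩q∣≡∣p∣+∣q∣ p q ⟩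
    ∣ p ∣ + ∣ q ∣         ∎
    where open ≡-Reasoning

  ⟦_⟧ : ∀ {n} → List (Fin n) → Subset n
  ⟦ xs ⟧ = ⋃ (map ⁅_⁆ xs)

  ∈⟦⟧⁺ : ∀ {n} {x : Fin n} {xs} → x ∈ xs → x ∈ₛ ⟦ xs ⟧
  ∈⟦⟧⁺ (here refl)  = x∈p∪q⁺ (inj₁ (x∈⁅x⁆ _))
  ∈⟦⟧⁺ (there x∈xs) = x∈p∪q⁺ (inj₂ (∈⟦⟧⁺ x∈xs))

  ∈⟦⟧⁻ : ∀ {n} {x : Fin n} xs → x ∈ₛ ⟦ xs ⟧ → x ∈ xs
  ∈⟦⟧⁻ []       x∈⊥ = contradiction x∈⊥ ∉⊥
  ∈⟦⟧⁻ (y ∷ xs) x∈  with x∈p∪q⁻ ⁅ y ⁆ ⟦ xs ⟧ x∈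
  ... | inj₁ x∈⁅y⁆ = here (x∈⁅y⁆⇒x≡y y x∈⁅y⁆)
  ... | inj₂ x∈xs  = there (∈⟦⟧⁻ xs x∈xs)

  ∣⟦⟧∣ : ∀ {n} {xs : List (Fin n)} → Unique xs → ∣ ⟦ xs ⟧ ∣ ≡ length xs
  ∣⟦⟧∣ {n} {[]}      []              = ∣⊥∣≡0 n
  ∣⟦⟧∣ {xs = x ∷ xs} (x∉xs ∷ unique) =
    trans (∣p∪q∣≡∣p∣+∣q∣ disjoint) (cong₂ _+_ (∣⁅x⁆∣≡1 x) (∣⟦⟧∣ unique))
    where
    disjoint : ⁅ x ⁆ ∩ ⟦ xs ⟧ ≡ ⊥
    disjoint = Empty-unique λ (y , y∈) → let y∈⁅x⁆ , y∈xs = x∈p∩q⁻ ⁅ x ⁆ ⟦ xs ⟧ y∈ in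
      All.lookup x∉xs (∈⟦⟧⁻ xs y∈xs) (sym (x∈⁅y⁆⇒x≡y x y∈⁅x⁆))

  module _ {a} {A : Set a} where

    ∈-pair⇒↭ : ∀ {x y p q r : A} → x ≢ y → x ∈ p ∷ q ∷ r ∷ [] → y ∈ p ∷ q ∷ r ∷ [] →
               ∃ λ w → p ∷ q ∷ r ∷ [] ↭ x ∷ y ∷ w ∷ []
    ∈-pair⇒↭           x≢y (here refl)                 (here refl)                 = contradiction refl x≢y
    ∈-pair⇒↭           x≢y (there (here refl))         (there (here refl))         = contradiction refl x≢y
    ∈-pair⇒↭           x≢y (there (there (here refl))) (there (there (here refl))) = contradiction refl x≢y
    ∈-pair⇒↭ {r = r}   _   (here refl)                 (there (here refl))         = r , ↭-refl
    ∈-pair⇒↭ {p = p} {q} {r} _ (here refl)             (there (there (here refl))) =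
      q , ↭-prep p (↭-swap q r ↭-refl)
    ∈-pair⇒↭ {p = p} {q} {r} _ (there (here refl))     (here refl)                 = r , ↭-swap p q ↭-refl
    ∈-pair⇒↭ {p = p} {q} {r} _ (there (here refl))     (there (there (here refl))) =
      p , ↭-trans (↭-swap p q ↭-refl) (↭-prep q (↭-swap p r ↭-refl))
    ∈-pair⇒↭ {p = p} {q} {r} _ (there (there (here refl))) (here refl)             =
      q , ↭-trans (↭-prep p (↭-swap q r ↭-refl)) (↭-swap p r ↭-refl)
    ∈-pair⇒↭ {p = p} {q} {r} _ (there (there (here refl))) (there (here refl))     =
      p , ↭-trans (↭-trans (↭-swap p q ↭-refl) (↭-prep q (↭-swap p r ↭-refl))) (↭-swap q r ↭-refl)

    ∈-third : ∀ {x y w z : A} → z ≢ x → z ≢ y → z ∈ x ∷ y ∷ w ∷ [] → z ≡ w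
    ∈-third z≢x z≢y (here z≡x)                 = contradiction z≡x z≢x
    ∈-third z≢x z≢y (there (here z≡y))         = contradiction z≡y z≢y
    ∈-third z≢x z≢y (there (there (here z≡w))) = z≡w

  [m+n%d]%d≡[m+n]%d : ∀ a b d .{{_ : NonZero d}} → (a + b % d) % d ≡ (a + b) % d
  [m+n%d]%d≡[m+n]%d a b d = begin
    (a + b % d) % d         ≡⟨ %-distribˡ-+ a (b % d) d ⟩
    (a % d + b % d % d) % d ≡⟨ cong (λ v → (a % d + v) % d) (m%n%n≡m%n b d) ⟩
    (a % d + b % d) % d     ≡⟨ %-distribˡ-+ a b d ⟨
    (a + b) % d             ∎
    where open ≡-Reasoning

  %-cancelˡ-+ : ∀ {m} .{{_ : NonZero m}} a {w w′} → w < m → w′ < m → (a + w) % m ≡ (a + w′) % m → w ≡ w′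
  %-cancelˡ-+ {m} a {w} {w′} w<m w′<m eq = begin
    w                       ≡⟨ recover w<m ⟨
    (-a + (a + w) % m) % m  ≡⟨ cong (λ v → (-a + v) % m) eq ⟩
    (-a + (a + w′) % m) % m ≡⟨ recover w′<m ⟩
    w′                      ∎
    where
    open ≡-Reasoning
    -a = m ∸ a % m
    -a+a≡0 : (-a + a) % m ≡ 0
    -a+a≡0 = begin
      (-a + a) % m     ≡⟨ [m+n%d]%d≡[m+n]%d -a a m ⟨
      (-a + a % m) % m ≡⟨ cong (_% m) (m∸n+n≡m (m%n≤n a m)) ⟩
      m % m            ≡⟨ n%n≡0 m ⟩
      0                ∎
    recover : ∀ {v} → v < m → (-a + (a + v) % m) % m ≡ v
    recover {v} v<m = begin
      (-a + (a + v) % m) % m     ≡⟨ [m+n%d]%d≡[m+n]%d -a (a + v) m ⟩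
      (-a + (a + v)) % m         ≡⟨ cong (_% m) (+-assoc -a a v) ⟨
      (-a + a + v) % m           ≡⟨ %-distribˡ-+ (-a + a) v m ⟩
      ((-a + a) % m + v % m) % m ≡⟨ cong (λ r → (r + v % m) % m) -a+a≡0 ⟩
      v % m % m                  ≡⟨ m%n%n≡m%n v m ⟩
      v % m                      ≡⟨ m<n⇒m%n≡m v<m ⟩
      v                          ∎

  module CyclicTriples (m : ℕ) .{{_ : NonZero m}} where

    residue : List (Fin m) → ℕ
    residue xs = sum (map toℕ xs) % m

    residue-↭ : ∀ {xs ys} → xs ↭ ys → residue xs ≡ residue ys
    residue-↭ xs↭ys = cong (_% m) (sum-↭ (↭.map⁺ toℕ xs↭ys))

    residue₃ : ∀ x y w → residue (x ∷ y ∷ w ∷ []) ≡ (toℕ x + toℕ y + toℕ w) % m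
    residue₃ x y w = cong (_% m) (trans (cong (λ v → toℕ x + (toℕ y + v)) (+-identityʳ (toℕ w)))
                                        (sym (+-assoc (toℕ x) (toℕ y) (toℕ w))))

    third : Fin m → Fin m → Fin m → Fin m
    third j x y = (toℕ j + (m ∸ toℕ x) + (m ∸ toℕ y)) mod m

    triple : Fin m → Fin m → Fin m → List (Fin m)
    triple j x y = x ∷ y ∷ third j x y ∷ []

    residue-triple : ∀ j x y → residue (triple j x y) ≡ toℕ j
    residue-triple j x y = begin
      residue (triple j x y)                       ≡⟨ residue₃ x y (third j x y) ⟩
      (nx + ny + toℕ (third j x y)) % m            ≡⟨ cong (λ v → (nx + ny + v) % m) (toℕ-fromℕ< (m%n<n _ m)) ⟩
      (nx + ny + (nj + (m ∸ nx) + (m ∸ ny)) % m) % m ≡⟨ [m+n%d]%d≡[m+n]%d (nx + ny) _ m ⟩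
      (nx + ny + (nj + (m ∸ nx) + (m ∸ ny))) % m   ≡⟨ cong (_% m) (regroup nx ny nj (m ∸ nx) (m ∸ ny)) ⟩
      (nj + (nx + (m ∸ nx)) + (ny + (m ∸ ny))) % m ≡⟨ cong₂ (λ u v → (nj + u + v) % m)
                                                             (m+[n∸m]≡n (<⇒≤ (toℕ<n x))) (m+[n∸m]≡n (<⇒≤ (toℕ<n y))) ⟩
      (nj + m + m) % m                             ≡⟨ trans ([m+n]%n≡m%n (nj + m) m) ([m+n]%n≡m%n nj m) ⟩
      nj % m                                       ≡⟨ m<n⇒m%n≡m (toℕ<n j) ⟩
      nj                                           ∎
      where
      open ≡-Reasoning
      nx = toℕ x
      ny = toℕ y
      nj = toℕ j
      regroup : ∀ x y j p q → x + y + (j + p + q) ≡ j + (x + p) + (y + q)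
      regroup = solve-∀

    third-unique : ∀ {j x y w} → residue (x ∷ y ∷ w ∷ []) ≡ toℕ j → w ≡ third j x y
    third-unique {j} {x} {y} {w} residue≡j =
      toℕ-injective (%-cancelˡ-+ (toℕ x + toℕ y) (toℕ<n w) (toℕ<n (third j x y)) (begin
        (toℕ x + toℕ y + toℕ w) % m              ≡⟨ residue₃ x y w ⟨
        residue (x ∷ y ∷ w ∷ [])                 ≡⟨ trans residue≡j (sym (residue-triple j x y)) ⟩
        residue (triple j x y)                   ≡⟨ residue₃ x y (third j x y) ⟩
        (toℕ x + toℕ y + toℕ (third j x y)) % m  ∎))
      where open ≡-Reasoning

    third-comm : ∀ j x y → third j x y ≡ third j y x
    third-comm j x y = cong (_mod m) (xy∙z≈xz∙y (toℕ j) (m ∸ toℕ x) (m ∸ toℕ y))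

    third-involutive : ∀ j x y → third j x (third j x y) ≡ y
    third-involutive j x y = sym (third-unique {j} {x} {third j x y} {y}
      (trans (residue-↭ (↭-prep x (↭-swap (third j x y) y (↭-refl {x = []})))) (residue-triple j x y)))

    Increasing : Fin m → Fin m → Fin m → Set
    Increasing j x y = x Fin.< y × y Fin.< third j x y

    increasing? : ∀ j x y → Dec (Increasing j x y)
    increasing? j x y = (x <? y) ×-dec (y <? third j x y)

    Increasing⇒Unique : ∀ {j x y} → Increasing j x y → Unique (triple j x y)
    Increasing⇒Unique (x<y , y<w) = (<⇒≢ x<y ∷ <⇒≢ (<-trans x<y y<w) ∷ []) ∷ (<⇒≢ y<w ∷ []) ∷ [] ∷ []

    triple-↭⇒≡ : ∀ {j x y j′ x′ y′} → Increasing j x y → Increasing j′ x′ y′ →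
                 triple j x y ↭ triple j′ x′ y′ → x ≡ x′ × y ≡ y′
    triple-↭⇒≡ (x<y , y<w) (x′<y′ , y′<w′) p
      with x≡x′ ∷ y≡y′ ∷ _ ← ↗↭↗⇒≋ (≤-totalOrder m) (<⇒≤ x<y ∷ <⇒≤ y<w ∷ [-]) (<⇒≤ x′<y′ ∷ <⇒≤ y′<w′ ∷ [-]) (↭⇒↭ₛ p)
      = x≡x′ , y≡y′

    ∈-triple⇒↭ : ∀ {j a b x y} → x ≢ y → x ∈ triple j a b → y ∈ triple j a b → triple j a b ↭ triple j x y
    ∈-triple⇒↭ {j} {a} {b} {x} {y} x≢y x∈ y∈ with w , p ← ∈-pair⇒↭ x≢y x∈ y∈ =
      subst (λ v → triple j a b ↭ x ∷ y ∷ v ∷ [])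
            (third-unique {j} {x} {y} (trans (sym (residue-↭ p)) (residue-triple j a b))) p

    ⟦triple⟧-injective : ∀ {j a b j′ a′ b′} → Increasing j a b → Increasing j′ a′ b′ →
                         ⟦ triple j a b ⟧ ≡ ⟦ triple j′ a′ b′ ⟧ → j ≡ j′ × a ≡ a′ × b ≡ b′
    ⟦triple⟧-injective {j} {a} {b} {j′} {a′} {b′} inc@(a<b , b<c) inc′ same =
      toℕ-injective (trans (sym (residue-triple j a b)) (trans (residue-↭ p) (residue-triple j′ a′ b′))) ,
      triple-↭⇒≡ inc inc′ p
      where
      ∈′ : ∀ {v} → v ∈ triple j a b → v ∈ triple j′ a′ b′
      ∈′ v∈ = ∈⟦⟧⁻ (triple j′ a′ b′) (subst (_ ∈ₛ_) same (∈⟦⟧⁺ v∈))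
      completion : ∃ λ w → triple j′ a′ b′ ↭ a ∷ b ∷ w ∷ []
      completion = ∈-pair⇒↭ (<⇒≢ a<b) (∈′ (here refl)) (∈′ (there (here refl)))
      c≡w : third j a b ≡ proj₁ completion
      c≡w = ∈-third (≢-sym (<⇒≢ (<-trans a<b b<c))) (≢-sym (<⇒≢ b<c))
                    (↭.∈-resp-↭ (proj₂ completion) (∈′ (there (there (here refl)))))
      p : triple j a b ↭ triple j′ a′ b′
      p = ↭-sym (subst (λ v → triple j′ a′ b′ ↭ a ∷ b ∷ v ∷ []) (sym c≡w) (proj₂ completion))

    edgeIfIncreasing : Fin m → Fin m → Fin m → List (Subset m)
    edgeIfIncreasing j x y = keepIf (increasing? j x y) ⟦ triple j x y ⟧

    family : Fin m → List (Subset m)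
    family j = concat (tabulate λ x → concat (tabulate (edgeIfIncreasing j x)))

    count-family : ∀ {p} {P : Pred (Subset m) p} (P? : Decidable P) j →
      length (filter P? (family j)) ≡ ∑[ x < m ] ∑[ y < m ] χ (increasing? j x y ×-dec P? ⟦ triple j x y ⟧)
    count-family P? j =
      trans (count-concat-tabulate P? (λ x → concat (tabulate (edgeIfIncreasing j x)))) (∑-cong λ x →
      trans (count-concat-tabulate P? (edgeIfIncreasing j x)) (∑-cong λ y →
      count-keepIf P? (increasing? j x y) _))

    length-family : ∀ j → length (family j) ≡ ∑[ x < m ] ∑[ y < m ] χ (increasing? j x y)
    length-family j =
      trans (length-concat-tabulate (λ x → concat (tabulate (edgeIfIncreasing j x)))) (∑-cong λ x →
      trans (length-concat-tabulate (edgeIfIncreasing j x)) (∑-cong λ y →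
      length-keepIf (increasing? j x y) _))

    All-family : ∀ j → All (λ e → ∣ e ∣ ≡ 3) (family j)
    All-family j = concat⁺ (tabulate⁺ λ x → concat⁺ (tabulate⁺ λ y →
      All-keepIf (increasing? j x y) λ inc → ∣⟦⟧∣ (Increasing⇒Unique inc)))

    codegree-family : ∀ j {x y} → x ≢ y → length (filter (λ e → (x ∈? e) ×-dec (y ∈? e)) (family j)) ≤ 1
    codegree-family j {x} {y} x≢y = subst (_≤ 1) (sym (count-family contains? j))
      (∑∑≤1 (λ a b → χ (increasing? j a b ×-dec contains? ⟦ triple j a b ⟧)) (λ a b → χ≤1 _) unique)
      where
      contains? = λ e → (x ∈? e) ×-dec (y ∈? e)
      unique : ∀ {a b a′ b′} → 0 < χ (increasing? j a b ×-dec contains? ⟦ triple j a b ⟧) →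
               0 < χ (increasing? j a′ b′ ×-dec contains? ⟦ triple j a′ b′ ⟧) → a ≡ a′ × b ≡ b′
      unique {a} {b} {a′} {b′} pos pos′ =
        let inc , x∈ , y∈ = χ-pos (increasing? j a b ×-dec contains? _) pos
            inc′ , x∈′ , y∈′ = χ-pos (increasing? j a′ b′ ×-dec contains? _) pos′
        in triple-↭⇒≡ inc inc′ (↭-trans (∈-triple⇒↭ x≢y (∈⟦⟧⁻ _ x∈) (∈⟦⟧⁻ _ y∈))
                                        (↭-sym (∈-triple⇒↭ x≢y (∈⟦⟧⁻ _ x∈′) (∈⟦⟧⁻ _ y∈′))))

    module _ (j : Fin m) where

      pairCount : (Fin m → Fin m → Fin m → ℕ) → ℕ
      pairCount F = ∑[ x < m ] ∑[ y < m ] F x y (third j x y)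

      pairCount-mono : ∀ {F G} → (∀ x y w → F x y w ≤ G x y w) → pairCount F ≤ pairCount G
      pairCount-mono F≤G = ∑-mono-≤ λ x → ∑-mono-≤ λ y → F≤G x y _

      pairCount-+ : ∀ F G → pairCount (λ x y w → F x y w + G x y w) ≡ pairCount F + pairCount G
      pairCount-+ F G =
        trans (∑-cong λ x → ∑-distrib-+ (λ y → F x y (third j x y)) (λ y → G x y (third j x y)))
              (∑-distrib-+ (λ x → ∑[ y < m ] F x y (third j x y)) (λ x → ∑[ y < m ] G x y (third j x y)))

      pairCount-swap : ∀ F → pairCount F ≡ pairCount (λ x y w → F y x w)
      pairCount-swap F = trans (∑-comm (λ x y → F x y (third j x y)))
        (∑-cong λ x → ∑-cong λ y → cong (F y x) (third-comm j y x))

      pairCount-flip : ∀ F → pairCount F ≡ pairCount (λ x y w → F x w y)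
      pairCount-flip F = ∑-cong λ x → trans (∑-permute (λ y → F x y (third j x y)) (reflection x))
        (∑-cong λ y → cong (F x (third j x y)) (third-involutive j x y))
        where
        reflection : Fin m → Permutation m m
        reflection x = permutation (third j x) (third j x) (third-involutive j x) (third-involutive j x)

      permute : Fin 6 → (Fin m → Fin m → Fin m → ℕ) → Fin m → Fin m → Fin m → ℕ
      permute 0F F x y w = F x y w
      permute 1F F x y w = F y x w
      permute 2F F x y w = F x w y
      permute 3F F x y w = F w x y
      permute 4F F x y w = F y w x
      permute 5F F x y w = F w y x

      pairCount-permute : ∀ k F → pairCount (permute k F) ≡ pairCount F
      pairCount-permute 0F F = refl
      pairCount-permute 1F F = sym (pairCount-swap F)
      pairCount-permute 2F F = sym (pairCount-flip F)
      pairCount-permute 3F F = trans (sym (pairCount-flip (permute 1F F))) (sym (pairCount-swap F))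
      pairCount-permute 4F F = trans (sym (pairCount-swap (permute 2F F))) (sym (pairCount-flip F))
      pairCount-permute 5F F = trans (sym (pairCount-flip (permute 4F F))) (trans (sym (pairCount-swap (permute 2F F)))
                                                                                 (sym (pairCount-flip F)))

      pairCount-symmetrise : ∀ F → pairCount (λ x y w → ∑[ k < 6 ] permute k F x y w) ≡ 6 * pairCount F
      pairCount-symmetrise F = begin
        ∑[ x < m ] ∑[ y < m ] ∑[ k < 6 ] permute k F x y (third j x y)
          ≡⟨ ∑-cong (λ x → ∑-comm (λ y k → permute k F x y (third j x y))) ⟩
        ∑[ x < m ] ∑[ k < 6 ] ∑[ y < m ] permute k F x y (third j x y)
          ≡⟨ ∑-comm (λ x k → ∑[ y < m ] permute k F x y (third j x y)) ⟩
        ∑[ k < 6 ] pairCount (permute k F)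
          ≡⟨ ∑-cong (λ k → pairCount-permute k F) ⟩
        ∑[ k < 6 ] pairCount F
          ≡⟨ ∑-const 6 (pairCount F) ⟩
        6 * pairCount F ∎
        where open ≡-Reasoning

      ordered : Fin m → Fin m → Fin m → ℕ
      ordered x y w = χ ((x <? y) ×-dec (y <? w))

      coincident : Fin m → Fin m → Fin m → ℕ
      coincident x y w = χ (x ≟ᶠ y)

      coincidences : Fin m → Fin m → Fin m → ℕ
      coincidences x y w = coincident x y w + coincident x w y + coincident y w x

      arrangements : Fin m → Fin m → Fin m → ℕ
      arrangements x y w = ∑[ k < 6 ] permute k ordered x y w + coincidences x y w

      pairCount-coincident : pairCount coincident ≤ m
      pairCount-coincident = begin
        ∑[ x < m ] ∑[ y < m ] χ (x ≟ᶠ y)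
          ≤⟨ ∑-mono-≤ {m} (λ x → ∑≤1 (λ y → χ (x ≟ᶠ y)) (λ y → χ≤1 (x ≟ᶠ y))
               λ {y} {y′} pos pos′ → trans (sym (χ-pos (x ≟ᶠ y) pos)) (χ-pos (x ≟ᶠ y′) pos′)) ⟩
        ∑[ x < m ] 1
          ≡⟨ ∑-const m 1 ⟩
        m * 1
          ≡⟨ *-identityʳ m ⟩
        m ∎
        where open ≤-Reasoning

      pairCount-coincidences : pairCount coincidences ≤ 3 * m
      pairCount-coincidences = begin
        pairCount coincidences
          ≡⟨ pairCount-+ (λ x y w → coincident x y w + coincident x w y) (permute 4F coincident) ⟩
        pairCount (λ x y w → coincident x y w + coincident x w y) + pairCount (permute 4F coincident)
          ≡⟨ cong₂ _+_ (pairCount-+ coincident (permute 2F coincident)) (pairCount-permute 4F coincident) ⟩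
        pairCount coincident + pairCount (permute 2F coincident) + pairCount coincident
          ≡⟨ cong (λ c → pairCount coincident + c + pairCount coincident) (pairCount-permute 2F coincident) ⟩
        pairCount coincident + pairCount coincident + pairCount coincident
          ≤⟨ +-mono-≤ (+-mono-≤ pairCount-coincident pairCount-coincident) pairCount-coincident ⟩
        m + m + m
          ≡⟨ thrice m ⟩
        3 * m ∎
        where
        open ≤-Reasoning
        thrice : ∀ n → n + n + n ≡ 3 * n
        thrice = solve-∀

      ordered≤arrangements : ∀ k x y w → permute k ordered x y w ≤ arrangements x y w
      ordered≤arrangements k x y w = m≤n⇒m≤n+o (coincidences x y w) (f≤∑f (λ k → permute k ordered x y w) k)

      coincidences≤arrangements : ∀ x y w → coincidences x y w ≤ arrangements x y w
      coincidences≤arrangements x y w = m≤n+m (coincidences x y w) (∑[ k < 6 ] permute k ordered x y w)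

      arrangements≥1 : ∀ x y w → 1 ≤ arrangements x y w
      arrangements≥1 x y w with <-cmp x y | <-cmp y w | <-cmp x w
      ... | tri≈ _ x≡y _ | _            | _            = ≤-trans (χ-yes (x ≟ᶠ y) x≡y)
        (≤-trans (m≤n⇒m≤n+o (coincident y w x) (m≤m+n (coincident x y w) (coincident x w y)))
                 (coincidences≤arrangements x y w))
      ... | _            | _            | tri≈ _ x≡w _ = ≤-trans (χ-yes (x ≟ᶠ w) x≡w)
        (≤-trans (m≤n⇒m≤n+o (coincident y w x) (m≤n+m (coincident x w y) (coincident x y w)))
                 (coincidences≤arrangements x y w))
      ... | _            | tri≈ _ y≡w _ | _            = ≤-trans (χ-yes (y ≟ᶠ w) y≡w)
        (≤-trans (m≤n+m (coincident y w x) (coincident x y w + coincident x w y)) (coincidences≤arrangements x y w))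
      ... | tri< x<y _ _ | tri< y<w _ _ | _            =
        ≤-trans (χ-yes ((x <? y) ×-dec (y <? w)) (x<y , y<w)) (ordered≤arrangements 0F x y w)
      ... | tri> _ _ y<x | tri< _ _ _   | tri< x<w _ _ =
        ≤-trans (χ-yes ((y <? x) ×-dec (x <? w)) (y<x , x<w)) (ordered≤arrangements 1F x y w)
      ... | tri< _ _ _   | tri> _ _ w<y | tri< x<w _ _ =
        ≤-trans (χ-yes ((x <? w) ×-dec (w <? y)) (x<w , w<y)) (ordered≤arrangements 2F x y w)
      ... | tri< x<y _ _ | tri> _ _ _   | tri> _ _ w<x =
        ≤-trans (χ-yes ((w <? x) ×-dec (x <? y)) (w<x , x<y)) (ordered≤arrangements 3F x y w)
      ... | tri> _ _ _   | tri< y<w _ _ | tri> _ _ w<x =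
        ≤-trans (χ-yes ((y <? w) ×-dec (w <? x)) (y<w , w<x)) (ordered≤arrangements 4F x y w)
      ... | tri> _ _ y<x | tri> _ _ w<y | _            =
        ≤-trans (χ-yes ((w <? y) ×-dec (y <? x)) (w<y , y<x)) (ordered≤arrangements 5F x y w)

      family-size : m * m ≤ 6 * length (family j) + 3 * m
      family-size = begin
        m * m
          ≡⟨ trans (∑-cong {m} λ x → trans (∑-const m 1) (*-identityʳ m)) (∑-const m m) ⟨
        pairCount (λ _ _ _ → 1)
          ≤⟨ pairCount-mono arrangements≥1 ⟩
        pairCount arrangements
          ≡⟨ pairCount-+ (λ x y w → ∑[ k < 6 ] permute k ordered x y w) coincidences ⟩
        pairCount (λ x y w → ∑[ k < 6 ] permute k ordered x y w) + pairCount coincidences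
          ≤⟨ +-mono-≤ (≤-reflexive (pairCount-symmetrise ordered)) pairCount-coincidences ⟩
        6 * pairCount ordered + 3 * m
          ≡⟨ cong (λ c → 6 * c + 3 * m) (length-family j) ⟨
        6 * length (family j) + 3 * m ∎
        where open ≤-Reasoning

    module _ (t : ℕ) (t≤m : t ≤ m) where

      hyperedges : List (Subset m)
      hyperedges = concat (tabulate λ (i : Fin t) → family (inject≤ i t≤m))

      count-hyperedges : ∀ {p} {P : Pred (Subset m) p} (P? : Decidable P) →
        length (filter P? hyperedges) ≡ ∑[ i < t ] length (filter P? (family (inject≤ i t≤m)))
      count-hyperedges P? = count-concat-tabulate P? (λ i → family (inject≤ i t≤m))

      hyperedges-uniform : All (λ e → ∣ e ∣ ≡ 3) hyperedges
      hyperedges-uniform = concat⁺ (tabulate⁺ λ i → All-family (inject≤ i t≤m))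

      hyperedges-unique : Unique hyperedges
      hyperedges-unique = Unique-if-counts≤1 _≟ₛ_ hyperedges λ s → begin
        length (filter (_≟ₛ s) hyperedges)
          ≡⟨ trans (count-hyperedges (_≟ₛ s)) (∑-cong λ i → count-family (_≟ₛ s) (inject≤ i t≤m)) ⟩
        ∑[ i < t ] ∑[ a < m ] ∑[ b < m ] χ (increasing? (inject≤ i t≤m) a b ×-dec (⟦ triple (inject≤ i t≤m) a b ⟧ ≟ₛ s))
          ≤⟨ ∑∑∑≤1 _ (λ i a b → χ≤1 _) (unique s) ⟩
        1 ∎
        where
        open ≤-Reasoning
        _≟ₛ_ = ≡-dec Bool._≟_
        unique : ∀ s {i a b i′ a′ b′} →
          0 < χ (increasing? (inject≤ i t≤m) a b ×-dec (⟦ triple (inject≤ i t≤m) a b ⟧ ≟ₛ s)) →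
          0 < χ (increasing? (inject≤ i′ t≤m) a′ b′ ×-dec (⟦ triple (inject≤ i′ t≤m) a′ b′ ⟧ ≟ₛ s)) →
          i ≡ i′ × a ≡ a′ × b ≡ b′
        unique s {i} {a} {b} {i′} {a′} {b′} pos pos′ =
          let inc , e≡s = χ-pos (increasing? (inject≤ i t≤m) a b ×-dec (⟦ triple (inject≤ i t≤m) a b ⟧ ≟ₛ s)) pos
              inc′ , e′≡s = χ-pos (increasing? (inject≤ i′ t≤m) a′ b′ ×-dec (⟦ triple (inject≤ i′ t≤m) a′ b′ ⟧ ≟ₛ s)) pos′
              i≡i′ , a≡a′ , b≡b′ = ⟦triple⟧-injective inc inc′ (trans e≡s (sym e′≡s))
          in inject≤-injective t≤m t≤m i i′ i≡i′ , a≡a′ , b≡b′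

      hyperedges-codegree : ∀ x y → x ≢ y → length (filter (λ e → (x ∈? e) ×-dec (y ∈? e)) hyperedges) ≤ t
      hyperedges-codegree x y x≢y = begin
        length (filter (λ e → (x ∈? e) ×-dec (y ∈? e)) hyperedges)
          ≡⟨ count-hyperedges (λ e → (x ∈? e) ×-dec (y ∈? e)) ⟩
        ∑[ i < t ] length (filter (λ e → (x ∈? e) ×-dec (y ∈? e)) (family (inject≤ i t≤m)))
          ≤⟨ ∑-mono-≤ {t} (λ i → codegree-family (inject≤ i t≤m) x≢y) ⟩
        ∑[ i < t ] 1
          ≡⟨ trans (∑-const t 1) (*-identityʳ t) ⟩
        t ∎
        where open ≤-Reasoning

      hyperedges-size : t * (m * m) ≤ 6 * length hyperedges + t * (3 * m)
      hyperedges-size = begin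
        t * (m * m)
          ≡⟨ ∑-const t (m * m) ⟨
        ∑[ i < t ] (m * m)
          ≤⟨ ∑-mono-≤ {t} (λ i → family-size (inject≤ i t≤m)) ⟩
        ∑[ i < t ] (6 * length (family (inject≤ i t≤m)) + 3 * m)
          ≡⟨ ∑-distrib-+ (λ i → 6 * length (family (inject≤ i t≤m))) (λ _ → 3 * m) ⟩
        ∑[ i < t ] (6 * length (family (inject≤ i t≤m))) + ∑[ i < t ] (3 * m)
          ≡⟨ cong₂ _+_ (*-distribˡ-sum 6 (λ i → length (family (inject≤ i t≤m)))) (sym (∑-const t (3 * m))) ⟨
        6 * ∑[ i < t ] length (family (inject≤ i t≤m)) + t * (3 * m)
          ≡⟨ cong (λ c → 6 * c + t * (3 * m)) (length-concat-tabulate (λ i → family (inject≤ i t≤m))) ⟨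
        6 * length hyperedges + t * (3 * m) ∎
        where open ≤-Reasoning

      cyclicGraph : ThreeGraph m
      cyclicGraph = record { edges = hyperedges ; uniform = hyperedges-uniform ; distinct = hyperedges-unique }

  ex-lower-bound : ∀ {m t k} → t ≤ m → IsEx m t k → t * (m * m) ≤ 6 * k + t * (3 * m)
  ex-lower-bound {zero}  {t} _   _             = ≤-trans (≤-reflexive (*-zeroʳ t)) z≤n
  ex-lower-bound {suc m} {t} t≤m (_ , maximal) =
    ≤-trans (hyperedges-size t t≤m)
            (+-monoˡ-≤ (t * (3 * suc m)) (*-monoʳ-≤ 6 (maximal (cyclicGraph t t≤m) (hyperedges-codegree t t≤m))))
    where open CyclicTriples (suc m)

module EdgeCounts where

  open Inequalities
  open CyclicConstruction using (∣p∪q∣≡∣p∣+∣q∣)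
  open import Data.Nat using (zero; suc; z≤n; s≤s)
  open import Data.Nat.Properties
    using (m≤n⇒∃[o]m+o≡n; ≤-trans; ≤-reflexive; m≤m+n; +-mono-≤; +-monoˡ-≤; +-monoʳ-≤; *-monoʳ-≤;
           +-cancelˡ-≤; +-cancelʳ-<; *-cancelˡ-<; module ≤-Reasoning)
  open import Data.Nat.DivMod using (m/n≡1+[m∸n]/n; m*n/n≡m; /-monoˡ-≤)
  open import Data.Nat.Combinatorics using (nCk+nC[k+1]≡[n+1]C[k+1]; nC1≡n)
  open import Data.Fin.Subset using (_∪_; _∩_; ⊥; ⊤)
  open import Data.Fin.Subset.Properties using (∣⊤∣≡n; ∩-distribˡ-∪; ∪-identityˡ)
  open import Data.List using ([]; _∷_)
  open import Data.Product using (_,_)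
  open import Relation.Binary.PropositionalEquality
  open import Data.Nat.Tactic.RingSolver using (solve-∀; solve)

  2*nC2+n≡n*n : ∀ n → 2 * (n C 2) + n ≡ n * n
  2*nC2+n≡n*n zero    = refl
  2*nC2+n≡n*n (suc n) = begin
    2 * (suc n C 2) + suc n       ≡⟨ cong (λ c → 2 * c + suc n) (nCk+nC[k+1]≡[n+1]C[k+1] n 1) ⟨
    2 * (n C 1 + n C 2) + suc n   ≡⟨ cong (λ c → 2 * (c + n C 2) + suc n) (nC1≡n n) ⟩
    2 * (n + n C 2) + suc n       ≡⟨ regroup n (n C 2) ⟩
    2 * (n C 2) + n + (2 * n + 1) ≡⟨ cong (_+ (2 * n + 1)) (2*nC2+n≡n*n n) ⟩
    n * n + (2 * n + 1)           ≡⟨ solve (n ∷ []) ⟩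
    suc n * suc n                 ∎
    where
    open ≡-Reasoning
    regroup : ∀ n c → 2 * (n + c) + suc n ≡ 2 * c + n + (2 * n + 1)
    regroup = solve-∀

  6*nC3≤n*n*n : ∀ n → 6 * (n C 3) ≤ n * n * n
  6*nC3≤n*n*n zero    = z≤n
  6*nC3≤n*n*n (suc n) = begin
    6 * (suc n C 3)                       ≡⟨ cong (6 *_) (nCk+nC[k+1]≡[n+1]C[k+1] n 2) ⟨
    6 * (n C 2 + n C 3)                   ≤⟨ m≤m+n _ (3 * n) ⟩
    6 * (n C 2 + n C 3) + 3 * n           ≡⟨ regroup n (n C 2) (n C 3) ⟩
    3 * (2 * (n C 2) + n) + 6 * (n C 3)   ≡⟨ cong (λ c → 3 * c + 6 * (n C 3)) (2*nC2+n≡n*n n) ⟩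
    3 * (n * n) + 6 * (n C 3)             ≤⟨ +-monoʳ-≤ (3 * (n * n)) (6*nC3≤n*n*n n) ⟩
    3 * (n * n) + n * n * n               ≤⟨ m≤m+n _ (3 * n + 1) ⟩
    3 * (n * n) + n * n * n + (3 * n + 1) ≡⟨ solve (n ∷ []) ⟩
    suc n * suc n * suc n                 ∎
    where
    open ≤-Reasoning
    regroup : ∀ n c d → 6 * (c + d) + 3 * n ≡ 3 * (2 * c + n) + 6 * d
    regroup = solve-∀

  data Thirds : ℕ → ℕ → ℕ → ℕ → Set where
    thirds₀ : ∀ q → Thirds (q * 3)     q q       q
    thirds₁ : ∀ q → Thirds (q * 3 + 1) q q       (suc q)
    thirds₂ : ∀ q → Thirds (q * 3 + 2) q (suc q) (suc q)

  Thirds-suc : ∀ {n m₁ m₂ m₃} → Thirds n m₁ m₂ m₃ → Thirds (3 + n) (suc m₁) (suc m₂) (suc m₃)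
  Thirds-suc (thirds₀ q) = thirds₀ (suc q)
  Thirds-suc (thirds₁ q) = thirds₁ (suc q)
  Thirds-suc (thirds₂ q) = thirds₂ (suc q)

  [3+n]/3≡1+n/3 : ∀ n → (3 + n) / 3 ≡ suc (n / 3)
  [3+n]/3≡1+n/3 n = m/n≡1+[m∸n]/n {3 + n} {3} (s≤s (s≤s (s≤s z≤n)))

  thirds : ∀ n → Thirds n (n / 3) ((n + 1) / 3) ((n + 2) / 3)
  thirds 0 = thirds₀ 0
  thirds 1 = thirds₁ 0
  thirds 2 = thirds₂ 0
  thirds (suc (suc (suc n)))
    rewrite [3+n]/3≡1+n/3 n | [3+n]/3≡1+n/3 (n + 1) | [3+n]/3≡1+n/3 (n + 2) = Thirds-suc (thirds n)

  Thirds-sum : ∀ {n m₁ m₂ m₃} → Thirds n m₁ m₂ m₃ → m₁ + m₂ + m₃ ≡ n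
  Thirds-sum (thirds₀ q) = solve (q ∷ [])
  Thirds-sum (thirds₁ q) = solve (q ∷ [])
  Thirds-sum (thirds₂ q) = solve (q ∷ [])

  Thirds-cube : ∀ {n m₁ m₂ m₃} → Thirds n m₁ m₂ m₃ → n * n * n ≤ 27 * (m₁ * m₂ * m₃) + 3 * n + 2
  Thirds-cube (thirds₀ q) = m+k≡n⇒m≤n (3 * (q * 3) + 2) (solve (q ∷ []))
  Thirds-cube (thirds₁ q) = m+k≡n⇒m≤n 4 (solve (q ∷ []))
  Thirds-cube (thirds₂ q) = ≤-reflexive (solve (q ∷ []))

  partition-size : ∀ {n} {T W₁ W₂ W₃ : Subset n} → IsPartitionOfComplement T W₁ W₂ W₃ →
                   ∣ T ∣ + (∣ W₁ ∣ + (∣ W₂ ∣ + ∣ W₃ ∣)) ≡ n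
  partition-size {n} {T} {W₁} {W₂} {W₃} (cover , T∩W₁ , T∩W₂ , T∩W₃ , W₁∩W₂ , W₁∩W₃ , W₂∩W₃) = begin
    ∣ T ∣ + (∣ W₁ ∣ + (∣ W₂ ∣ + ∣ W₃ ∣)) ≡⟨ cong (λ k → ∣ T ∣ + (∣ W₁ ∣ + k)) (∣p∪q∣≡∣p∣+∣q∣ W₂∩W₃) ⟨
    ∣ T ∣ + (∣ W₁ ∣ + ∣ W₂ ∪ W₃ ∣)       ≡⟨ cong (∣ T ∣ +_) (∣p∪q∣≡∣p∣+∣q∣ (∩-∪-⊥ W₁∩W₂ W₁∩W₃)) ⟨
    ∣ T ∣ + ∣ W₁ ∪ W₂ ∪ W₃ ∣             ≡⟨ ∣p∪q∣≡∣p∣+∣q∣ (∩-∪-⊥ T∩W₁ (∩-∪-⊥ T∩W₂ T∩W₃)) ⟨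
    ∣ T ∪ W₁ ∪ W₂ ∪ W₃ ∣                 ≡⟨ cong ∣_∣ cover ⟩
    ∣ ⊤ {n} ∣                            ≡⟨ ∣⊤∣≡n n ⟩
    n                                    ∎
    where
    open ≡-Reasoning
    ∩-∪-⊥ : ∀ {p q r : Subset n} → p ∩ q ≡ ⊥ → p ∩ r ≡ ⊥ → p ∩ (q ∪ r) ≡ ⊥
    ∩-∪-⊥ {p} {q} {r} p∩q≡⊥ p∩r≡⊥ = trans (∩-distribˡ-∪ p q r) (trans (cong₂ _∪_ p∩q≡⊥ p∩r≡⊥) (∪-identityˡ ⊥))

  edges-upper-bound : ∀ t a b c → 27 * t ≤ a + b + c →
    54 * (a * b * c + t * (a C 2 + b C 2 + c C 2) + t C 3) + 27 * t * (a + b + c)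
      ≤ 2 * ((a + b + c) * (a + b + c) * (a + b + c)) + 9 * t * ((a + b + c) * (a + b + c)) + 9 * (t * t * t)
  edges-upper-bound t a b c 27t≤s = begin
    54 * (a * b * c + t * (a C 2 + b C 2 + c C 2) + t C 3) + 27 * t * (a + b + c)
      ≡⟨ regroup (a C 2) (b C 2) (c C 2) (t C 3) ⟩
    27 * (2 * (a * b * c) + t * ((2 * (a C 2) + a) + (2 * (b C 2) + b) + (2 * (c C 2) + c))) + 9 * (6 * (t C 3))
      ≡⟨ cong (λ q → 27 * (2 * (a * b * c) + t * q) + 9 * (6 * (t C 3)))
              (cong₂ _+_ (cong₂ _+_ (2*nC2+n≡n*n a) (2*nC2+n≡n*n b)) (2*nC2+n≡n*n c)) ⟩
    27 * (2 * (a * b * c) + t * (a * a + b * b + c * c)) + 9 * (6 * (t C 3))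
      ≤⟨ +-mono-≤ (cubic-bound t a b c 27t≤s) (*-monoʳ-≤ 9 (6*nC3≤n*n*n t)) ⟩
    2 * ((a + b + c) * (a + b + c) * (a + b + c)) + 9 * t * ((a + b + c) * (a + b + c)) + 9 * (t * t * t) ∎
    where
    open ≤-Reasoning
    regroup : ∀ A B C D →
      54 * (a * b * c + t * (A + B + C) + D) + 27 * t * (a + b + c)
        ≡ 27 * (2 * (a * b * c) + t * ((2 * A + a) + (2 * B + b) + (2 * C + c))) + 9 * (6 * D)
    regroup A B C D = solve (t ∷ a ∷ b ∷ c ∷ A ∷ B ∷ C ∷ D ∷ [])

  s°-lower-bound : ∀ {n m₁ m₂ m₃} t k₁ k₂ k₃ → Thirds n m₁ m₂ m₃ →
    t * (m₁ * m₁) ≤ 6 * k₁ + t * (3 * m₁) →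
    t * (m₂ * m₂) ≤ 6 * k₂ + t * (3 * m₂) →
    t * (m₃ * m₃) ≤ 6 * k₃ + t * (3 * m₃) →
    6 * (n * n * n) + 9 * t * (n * n) ≤ 162 * (m₁ * m₂ * m₃ + k₁ + k₂ + k₃) + 81 * t * n + 18 * n + 12
  s°-lower-bound {n} {m₁} {m₂} {m₃} t k₁ k₂ k₃ th ex₁ ex₂ ex₃ = begin
    6 * (n * n * n) + 9 * t * (n * n)
      ≤⟨ +-mono-≤ (*-monoʳ-≤ 6 (Thirds-cube th)) (*-monoʳ-≤ (9 * t) n²≤3Σm²) ⟩
    6 * (27 * (m₁ * m₂ * m₃) + 3 * n + 2) + 9 * t * (3 * (m₁ * m₁ + m₂ * m₂ + m₃ * m₃))
      ≡⟨ solve (n ∷ t ∷ m₁ ∷ m₂ ∷ m₃ ∷ []) ⟩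
    162 * (m₁ * m₂ * m₃) + 18 * n + 12 + 27 * (t * (m₁ * m₁) + t * (m₂ * m₂) + t * (m₃ * m₃))
      ≤⟨ +-monoʳ-≤ (162 * (m₁ * m₂ * m₃) + 18 * n + 12) (*-monoʳ-≤ 27 (+-mono-≤ (+-mono-≤ ex₁ ex₂) ex₃)) ⟩
    162 * (m₁ * m₂ * m₃) + 18 * n + 12
      + 27 * ((6 * k₁ + t * (3 * m₁)) + (6 * k₂ + t * (3 * m₂)) + (6 * k₃ + t * (3 * m₃)))
      ≡⟨ solve (n ∷ t ∷ m₁ ∷ m₂ ∷ m₃ ∷ k₁ ∷ k₂ ∷ k₃ ∷ []) ⟩
    162 * (m₁ * m₂ * m₃ + k₁ + k₂ + k₃) + 81 * t * (m₁ + m₂ + m₃) + 18 * n + 12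
      ≡⟨ cong (λ s → 162 * (m₁ * m₂ * m₃ + k₁ + k₂ + k₃) + 81 * t * s + 18 * n + 12) (Thirds-sum th) ⟩
    162 * (m₁ * m₂ * m₃ + k₁ + k₂ + k₃) + 81 * t * n + 18 * n + 12 ∎
    where
    open ≤-Reasoning
    n²≤3Σm² : n * n ≤ 3 * (m₁ * m₁ + m₂ * m₂ + m₃ * m₃)
    n²≤3Σm² = subst (λ s → s * s ≤ _) (Thirds-sum th) ([x+y+z]²≤3[x²+y²+z²] m₁ m₂ m₃)

  cubic-gap : ∀ t s → 1 ≤ t → 27 * t + 100 ≤ s →
    30 * (2 * (s * s * s) + 9 * t * (s * s) + 9 * (t * t * t)) + 162 * (t + s) + 10 * (81 * t * (t + s) + 18 * (t + s) + 12)
      < 10 * (6 * ((t + s) * (t + s) * (t + s)) + 9 * t * ((t + s) * (t + s))) + 30 * (27 * t * s)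
  cubic-gap t s 1≤t 27t+100≤s
    with u , refl ← m≤n⇒∃[o]m+o≡n 1≤t
    with d , refl ← m≤n⇒∃[o]m+o≡n 27t+100≤s
    = <-by-slack (expand (1 + u) (27 * (1 + u) + 100 + d))
        (m+k≡n⇒m≤n (893 + 18 * d + 89604 * u + 720 * u * d + 63990 * u * u + 360 * u * u * d + 9600 * u * u * u)
                   (positive u d))
    where
    expand : ∀ t s →
      30 * (2 * (s * s * s) + 9 * t * (s * s) + 9 * (t * t * t)) + 162 * (t + s) + 10 * (81 * t * (t + s) + 18 * (t + s) + 12)
        + 360 * (s * (t * t))
      ≡ 10 * (6 * ((t + s) * (t + s) * (t + s)) + 9 * t * ((t + s) * (t + s))) + 30 * (27 * t * s)
        + (120 * (t * t * t) + 810 * (t * t) + 342 * t + 342 * s + 120)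
    expand = solve-∀
    positive : ∀ u d →
      suc (120 * ((1 + u) * (1 + u) * (1 + u)) + 810 * ((1 + u) * (1 + u)) + 342 * (1 + u)
           + 342 * (27 * (1 + u) + 100 + d) + 120)
        + (893 + 18 * d + 89604 * u + 720 * u * d + 63990 * u * u + 360 * u * u * d + 9600 * u * u * u)
      ≡ 360 * ((27 * (1 + u) + 100 + d) * ((1 + u) * (1 + u)))
    positive = solve-∀

  -- Both sides are multiplied by 162 = 6 · 27, which clears the denominators of the two bounds.
  edge-count-gap : ∀ {t n m₁ m₂ m₃ k₁ k₂ k₃} a b c → 1 ≤ t → 27 * t + 100 ≤ a + b + c → t + (a + b + c) ≡ n →
    Thirds n m₁ m₂ m₃ →
    t * (m₁ * m₁) ≤ 6 * k₁ + t * (3 * m₁) →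
    t * (m₂ * m₂) ≤ 6 * k₂ + t * (3 * m₂) →
    t * (m₃ * m₃) ≤ 6 * k₃ + t * (3 * m₃) →
    10 * (a * b * c + t * (a C 2 + b C 2 + c C 2) + t C 3) + n < 10 * (m₁ * m₂ * m₃ + k₁ + k₂ + k₃)
  edge-count-gap {t} {n} {m₁} {m₂} {m₃} {k₁} {k₂} {k₃} a b c 1≤t large refl th ex₁ ex₂ ex₃ =
    *-cancelˡ-< 162 _ _ (+-cancelʳ-< X _ _ (begin-strict
      162 * (10 * e + n) + X
        ≡⟨ regroupˡ e n t (a + b + c) Y ⟩
      30 * (54 * e + 27 * t * (a + b + c)) + 162 * n + 10 * Y
        ≤⟨ +-monoˡ-≤ (10 * Y) (+-monoˡ-≤ (162 * n)
             (*-monoʳ-≤ 30 (edges-upper-bound t a b c (≤-trans (m≤m+n (27 * t) 100) large)))) ⟩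
      30 * (2 * ((a + b + c) * (a + b + c) * (a + b + c)) + 9 * t * ((a + b + c) * (a + b + c)) + 9 * (t * t * t))
        + 162 * n + 10 * Y
        <⟨ cubic-gap t (a + b + c) 1≤t large ⟩
      10 * (6 * (n * n * n) + 9 * t * (n * n)) + 30 * (27 * t * (a + b + c))
        ≤⟨ +-monoˡ-≤ (30 * (27 * t * (a + b + c))) (*-monoʳ-≤ 10 (s°-lower-bound t k₁ k₂ k₃ th ex₁ ex₂ ex₃)) ⟩
      10 * (162 * s° + 81 * t * n + 18 * n + 12) + 30 * (27 * t * (a + b + c))
        ≡⟨ regroupʳ s° n t (a + b + c) ⟩
      162 * (10 * s°) + X ∎))
    where
    open ≤-Reasoning
    e  = a * b * c + t * (a C 2 + b C 2 + c C 2) + t C 3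
    s° = m₁ * m₂ * m₃ + k₁ + k₂ + k₃
    Y  = 81 * t * n + 18 * n + 12
    X  = 30 * (27 * t * (a + b + c)) + 10 * Y
    regroupˡ : ∀ e n t s y →
      162 * (10 * e + n) + (30 * (27 * t * s) + 10 * y) ≡ 30 * (54 * e + 27 * t * s) + 162 * n + 10 * y
    regroupˡ = solve-∀
    regroupʳ : ∀ s° n t s → 10 * (162 * s° + 81 * t * n + 18 * n + 12) + 30 * (27 * t * s)
                           ≡ 162 * (10 * s°) + (30 * (27 * t * s) + 10 * (81 * t * n + 18 * n + 12))
    regroupʳ = solve-∀

  27t+100≤s : ∀ {t s} → 28 * t + 100 ≤ t + s → 27 * t + 100 ≤ s
  27t+100≤s {t} {s} h = +-cancelˡ-≤ t (27 * t + 100) s (≤-trans (≤-reflexive (split t)) h)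
    where
    split : ∀ t → t + (27 * t + 100) ≡ 28 * t + 100
    split = solve-∀

  t*3≤n : ∀ {t n} → 28 * t + 100 ≤ n → t * 3 ≤ n
  t*3≤n {t} h = ≤-trans (m+k≡n⇒m≤n (t * 25 + 100) (split t)) h
    where
    split : ∀ t → t * 3 + (t * 25 + 100) ≡ 28 * t + 100
    split = solve-∀

  t≤n/3 : ∀ {t n} → t * 3 ≤ n → t ≤ n / 3
  t≤n/3 {t} {n} t*3≤n = subst (_≤ n / 3) (m*n/n≡m t 3) (/-monoˡ-≤ 3 t*3≤n)

open CyclicConstruction using (ex-lower-bound)
open EdgeCounts using (partition-size; thirds; edge-count-gap; 27t+100≤s; t*3≤n; t≤n/3)

lemma2p4 : (t : ℕ) → 1 ≤ t →
    Σ ℕ λ N → (n : ℕ) → N ≤ n →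
      (T W₁ W₂ W₃ : Subset n) → ∣ T ∣ ≡ t →
      IsPartitionOfComplement T W₁ W₂ W₃ →
      (k₁ k₂ k₃ : ℕ) →
      IsEx (n / 3) t k₁ → IsEx ((n + 1) / 3) t k₂ → IsEx ((n + 2) / 3) t k₃ →
      10 * (∣ W₁ ∣ * ∣ W₂ ∣ * ∣ W₃ ∣
             + t * ((∣ W₁ ∣ C 2) + (∣ W₂ ∣ C 2) + (∣ W₃ ∣ C 2))
             + t C 3) + n
        < 10 * ((n / 3) * ((n + 1) / 3) * ((n + 2) / 3) + k₁ + k₂ + k₃)
lemma2p4 t 1≤t = 28 * t + 100 , λ n N≤n T W₁ W₂ W₃ ∣T∣≡t partition k₁ k₂ k₃ ex₁ ex₂ ex₃ →
  let t+s≡n = trans (cong₂ _+_ (sym ∣T∣≡t) (+-assoc (∣ W₁ ∣) (∣ W₂ ∣) (∣ W₃ ∣))) (partition-size partition)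
      3t≤n  = t*3≤n {t} N≤n
  in edge-count-gap (∣ W₁ ∣) (∣ W₂ ∣) (∣ W₃ ∣) 1≤t (27t+100≤s {t} (subst (28 * t + 100 ≤_) (sym t+s≡n) N≤n))
       t+s≡n (thirds n)
       (ex-lower-bound (t≤n/3 3t≤n) ex₁)
       (ex-lower-bound (t≤n/3 (m≤n⇒m≤n+o 1 3t≤n)) ex₂)
       (ex-lower-bound (t≤n/3 (m≤n⇒m≤n+o 2 3t≤n)) ex₃)
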